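{- Let $(T_H,T_P)$ be a fully resolved nested tree of type $(n,m,\ell)$ with host ranked topology $rt_H$, parasite ranked topology $rt_P$ and nesting sequence $S$. If $S'$ is any word with $S\le S'$ in the nesting sequence poset, then there is a fully resolved nested tree of type $(n,m,\ell)$ with host ranked topology $rt_H$, parasite ranked topology $rt_P$ and nesting sequence $S'$; i.e. $(rt_H,rt_P,\ell,S')$ is a nested ranked topology.
   Context: An ultrametric phylogenetic tree on a finite leaf set $L$ is a rooted tree with leaves bijectively labelled by $L$, no non-root degree-2 vertices, nonnegative edge lengths and all leaves equidistant from the root; leaves sit at time $0$ and each internal vertex has time equal to its distance to its descendant leaves; $d_T(i,j)$ is leaf-to-leaf path length. A nested tree of type $(n,m,\ell)$, for $\ell:[m]\to[n]$, is a pair $(T_H,T_P)$ of such trees on $[n]$ and $[m]$ with $d^P(i,j)\ge d^H(\ell(i),\ell(j))$ for all $i,j\in[m]$. It is fully resolved if both trees are binary and all $n+m-2$ internal vertices of the two trees have pairwise distinct times; listing them by increasing time, the nesting sequence $S\in\{H,P\}^{n+m-2}$ has $S_i=H$ or $P$ according as the $i$-th vertex lies in $T_H$ or $T_P$. The ranked topology of a binary tree with distinct internal times is its leaf-labelled rooted shape together with the total order of its internal vertices by time. The nesting sequence poset on words in $\{H,P\}^{n+m-2}$ is the reflexive–transitive closure of the relation $S\le S'$ whenever there is $i$ with $S_i=P$, $S_{i+1}=H$, and $S'$ equals $S$ except that $S'_i=H$, $S'_{i+1}=P$.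
   Formalization: The internal vertex times and edge lengths of both trees of each nested tree are rational numbers. -}

module Defs where

open import Data.Nat using (ℕ)
open import Data.Fin using (Fin)
open import Data.List using (List; []; _∷_; _++_; map; filter; length)
open import Data.Maybe using (Maybe; just; nothing; maybe)
open import Data.Product using (_×_; Σ; ∃; _,_)
open import Data.Bool using (if_then_else_; true)
open import Relation.Nullary using (¬_; does)
open import Relation.Binary.PropositionalEquality using (_≡_; _≢_)
open import Data.Rational using (ℚ; 0ℚ; _≤_; _<_; _*_; _+_)
open import Data.Rational.Properties using (_≟_; _<?_; ≤-decTotalOrder)
open import Data.List.Sort ≤-decTotalOrder using (sort)
open import Data.List.Membership.DecPropositional _≟_ using (_∈?_)
import Data.List.Membership.DecPropositional as DP
open import Data.List.Relation.Unary.AllPairs using (AllPairs)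
open import Data.List.Relation.Binary.Permutation.Propositional using (_↭_)
open import Relation.Binary.Construct.Closure.ReflexiveTransitive using (Star)
import Data.Fin.Properties as FinP
import Data.Fin as F
open import Data.List using (allFin)

-- Binary rooted trees with leaves labelled in A; each internal vertex
-- carries a label (its time, or later its rank).
data BTree (A : Set) (B : Set) : Set where
  leaf : A → BTree A B
  node : B → BTree A B → BTree A B → BTree A B

leaves : ∀ {A B} → BTree A B → List A
leaves (leaf a)     = a ∷ []
leaves (node _ l r) = leaves l ++ leaves r

internalTimes : ∀ {A B} → BTree A B → List B
internalTimes (leaf _)     = []
internalTimes (node t l r) = t ∷ internalTimes l ++ internalTimes r

time : ∀ {A} → BTree A ℚ → ℚ
time (leaf _)     = 0ℚ
time (node t _ _) = t

-- Timed binary tree whose internal vertices have time at least that of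
-- their children (i.e. all edge lengths, parent time minus child time,
-- are nonnegative); all leaves are then at distance t(root) from the root.
data Ultrametric {A : Set} : BTree A ℚ → Set where
  leafU : ∀ a → Ultrametric (leaf a)
  nodeU : ∀ {t l r} → time l ≤ t → time r ≤ t →
          Ultrametric l → Ultrametric r → Ultrametric (node t l r)

record BinUltraTree (n : ℕ) : Set where
  constructor mkTree
  field
    tree   : BTree (Fin n) ℚ
    ultra  : Ultrametric tree
    labels : leaves tree ↭ allFin n
open BinUltraTree public

mrcaTime : ∀ {n} → BTree (Fin n) ℚ → Fin n → Fin n → Maybe ℚ
mrcaTime (leaf x) a b with does (a F.≟ x) | does (b F.≟ x)
... | true | true = just 0ℚ
... | _ | _ = nothing
mrcaTime (node t l r) a b with mrcaTime l a b | mrcaTime r a b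
... | just s | _      = just s
... | nothing | just s = just s
... | nothing | nothing with does (DP._∈?_ F._≟_ a (leaves (node t l r))) | does (DP._∈?_ F._≟_ b (leaves (node t l r)))
...   | true | true = just t
...   | _ | _ = nothing

-- leaf-to-leaf path length in an ultrametric tree: the path from a to b
-- goes up to their mrca and down again, so its length is 2·t(mrca).
dist : ∀ {n} → BinUltraTree n → Fin n → Fin n → ℚ
dist T a b = maybe (λ t → t + t) 0ℚ (mrcaTime (tree T) a b)

record FRNestedTree (n m : ℕ) (ℓ : Fin m → Fin n) : Set where
  field
    host     : BinUltraTree n
    parasite : BinUltraTree m
    nested   : ∀ i j → dist host (ℓ i) (ℓ j) ≤ dist parasite i j
    distinct : AllPairs _≢_ (internalTimes (tree host) ++ internalTimes (tree parasite))
open FRNestedTree public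

data HP : Set where
  H P : HP

nestingSequence : ∀ {n m ℓ} → FRNestedTree n m ℓ → List HP
nestingSequence N =
  map (λ t → if does (t ∈? hs) then H else P) (sort (hs ++ ps))
  where
    hs = internalTimes (tree (host N))
    ps = internalTimes (tree (parasite N))

-- Ranked topology: replace each internal time by its rank (number of
-- internal times of the tree strictly smaller), and compare up to
-- swapping children (trees are unordered).
rankOf : List ℚ → ℚ → ℕ
rankOf ts t = length (filter (_<? t) ts)

relabel : ∀ {A B C} → (B → C) → BTree A B → BTree A C
relabel f (leaf a)     = leaf a
relabel f (node t l r) = node (f t) (relabel f l) (relabel f r)

rankify : ∀ {A} → BTree A ℚ → BTree A ℕ
rankify T = relabel (rankOf (internalTimes T)) T

data _≅_ {A B : Set} : BTree A B → BTree A B → Set where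
  leaf≅ : ∀ a → leaf a ≅ leaf a
  same≅ : ∀ {t l r l' r'} → l ≅ l' → r ≅ r' → node t l r ≅ node t l' r'
  swap≅ : ∀ {t l r l' r'} → l ≅ r' → r ≅ l' → node t l r ≅ node t l' r'

SameRankedTopology : ∀ {n} → BinUltraTree n → BinUltraTree n → Set
SameRankedTopology T T' = rankify (tree T) ≅ rankify (tree T')

data Step : List HP → List HP → Set where
  step : ∀ xs ys → Step (xs ++ P ∷ H ∷ ys) (xs ++ H ∷ P ∷ ys)

_≤ₙ_ : List HP → List HP → Set
_≤ₙ_ = Star Step

-- A covering step PH ↦ HP swaps a parasite vertex at time p with the host vertex
-- at the next time h. Move p to any p' strictly between h and the following
-- internal time. Since no other vertex time lies in (p, p'], this retiming is
-- strictly monotone on the parasite times, so the parasite keeps its ranked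
-- topology and stays ultrametric; it only raises parasite times, so parasite
-- distances grow and the nesting inequalities survive; the host is untouched.
-- Iterating along a chain of covering steps gives the theorem.
module Submission where

open import Defs
open import Data.Bool using (if_then_else_; true; false)
open import Data.Empty using (⊥-elim)
open import Data.Fin using (Fin)
import Data.Fin as Fin
open import Data.List using (List; []; _∷_; _++_; map; filter; length; allFin)
open import Data.List.Properties using (map-++; map-id-local; ∷-injective; filter-accept; filter-reject)
open import Data.List.Membership.Propositional using (_∈_; _∉_)
open import Data.List.Membership.Propositional.Properties using (∈-++⁻; ∈-++⁺ˡ; ∈-++⁺ʳ)
import Data.List.Membership.DecPropositional as DecMembership
open import Data.List.Relation.Binary.Equality.Propositional using (≋⇒≡)
open import Data.List.Relation.Binary.Permutation.Propositional
  using (_↭_; ↭-refl; ↭-sym; ↭-trans; ↭-swap; ↭⇒↭ₛ; ↭⇒↭ₛ′; module PermutationReasoning)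
import Data.List.Relation.Binary.Permutation.Propositional.Properties as ↭
import Data.List.Relation.Binary.Permutation.Setoid.Properties as ↭ₛ
open import Data.List.Relation.Unary.All as All using (All; []; _∷_)
import Data.List.Relation.Unary.All.Properties as All
open import Data.List.Relation.Unary.AllPairs as AllPairs using (AllPairs; []; _∷_)
import Data.List.Relation.Unary.AllPairs.Properties as AllPairs
open import Data.List.Relation.Unary.Any using (here; there)
import Data.List.Relation.Unary.Sorted.TotalOrder.Properties as Sorted
open import Data.Maybe using (Maybe; maybe)
open import Data.Maybe.Relation.Binary.Pointwise using (Pointwise; just; nothing)
open import Data.Nat using (ℕ; suc)
open import Data.Product using (Σ; ∃; _×_; _,_; proj₁; proj₂)
open import Data.Rational using (ℚ; 0ℚ; 1ℚ; _≤_; _<_; _+_)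
open import Data.Rational.Properties
  using ( _≟_; _<?_; ≤-refl; ≤-trans; <⇒≤; <⇒≢; <-irrefl; <-asym; <-trans; <-≤-trans
        ; ≤-<-trans; <-cmp; ≮⇒≥; <-dense; +-mono-≤; +-monoʳ-<; +-identityʳ; positive⁻¹
        ; ≤-decTotalOrder)
open import Data.List.Sort ≤-decTotalOrder using (sort; sort-↭; sort-↗)
open import Data.List.Membership.DecPropositional _≟_ using (_∈?_)
open import Data.Sum using (_⊎_; inj₁; inj₂)
open import Relation.Binary.Bundles using (DecTotalOrder)
open import Relation.Binary.Construct.Closure.ReflexiveTransitive using (ε; _◅_)
open import Relation.Binary.Definitions using (tri<; tri≈; tri>)
open import Relation.Binary.PropositionalEquality
open import Relation.Nullary using (yes; no; does; Dec)

module _ {A : Set} {R : A → A → Set} where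

  AllPairs-++⁻ : ∀ xs {ys} → AllPairs R (xs ++ ys) →
                 AllPairs R xs × AllPairs R ys × All (λ x → All (R x) ys) xs
  AllPairs-++⁻ []       Rys          = [] , Rys , []
  AllPairs-++⁻ (x ∷ xs) (Rx ∷ Rxsys) with AllPairs-++⁻ xs Rxsys
  ... | Rxs , Rys , Rxsys′ = All.++⁻ˡ xs Rx ∷ Rxs , Rys , All.++⁻ʳ xs Rx ∷ Rxsys′

  AllPairs-resp-↭ : (∀ {x y} → R x y → R y x) →
                    ∀ {xs ys} → xs ↭ ys → AllPairs R xs → AllPairs R ys
  AllPairs-resp-↭ sym xs↭ys = ↭ₛ.AllPairs-resp-↭ (setoid A) sym (resp₂ R) (↭⇒↭ₛ xs↭ys)

map-≡-++-∷-∷⁻ : ∀ {A B : Set} (f : A → B) xs {u v ys} (zs : List A) →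
  map f zs ≡ xs ++ u ∷ v ∷ ys →
  Σ (List A) λ as → Σ A λ a → Σ A λ b → Σ (List A) λ bs →
    zs ≡ as ++ a ∷ b ∷ bs × map f as ≡ xs × f a ≡ u × f b ≡ v × map f bs ≡ ys
map-≡-++-∷-∷⁻ f [] (a ∷ b ∷ bs) refl = [] , a , b , bs , refl , refl , refl , refl , refl
map-≡-++-∷-∷⁻ f (x ∷ xs) (z ∷ zs) eq with ∷-injective eq
... | fz≡x , eq′ with map-≡-++-∷-∷⁻ f xs zs eq′
... | as , a , b , bs , zs≡ , eqs , fa≡ , fb≡ , eqbs =
  z ∷ as , a , b , bs , cong (z ∷_) zs≡ , cong₂ _∷_ fz≡x eqs , fa≡ , fb≡ , eqbs

≤⇒<⊎≡ : ∀ {x y : ℚ} → x ≤ y → x < y ⊎ x ≡ y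
≤⇒<⊎≡ {x} {y} x≤y with <-cmp x y
... | tri< x<y _ _ = inj₁ x<y
... | tri≈ _ x≡y _ = inj₂ x≡y
... | tri> _ _ y<x = ⊥-elim (<-irrefl refl (≤-<-trans x≤y y<x))

≤∧≢⇒< : ∀ {x y : ℚ} → x ≤ y → x ≢ y → x < y
≤∧≢⇒< x≤y x≢y with ≤⇒<⊎≡ x≤y
... | inj₁ x<y = x<y
... | inj₂ x≡y = ⊥-elim (x≢y x≡y)

∃-above-below-all : ∀ h bs → AllPairs _<_ (h ∷ bs) → ∃ λ q → h < q × All (q <_) bs
∃-above-below-all h [] _ =
  h + 1ℚ , subst (_< h + 1ℚ) (+-identityʳ h) (+-monoʳ-< h (positive⁻¹ 1ℚ)) , []
∃-above-below-all h (b ∷ bs) ((h<b ∷ _) ∷ b<bs ∷ _) with <-dense h<b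
... | q , h<q , q<b = q , h<q , q<b ∷ All.map (<-trans q<b) b<bs

private
  module ℚ≤ = DecTotalOrder ≤-decTotalOrder

sort-strictlyIncreasing : ∀ {xs} → AllPairs _≢_ xs → AllPairs _<_ (sort xs)
sort-strictlyIncreasing {xs} distinct =
  AllPairs.zipWith (λ (x≤y , x≢y) → ≤∧≢⇒< x≤y x≢y)
    ( Sorted.Sorted⇒AllPairs ℚ≤.totalOrder (sort-↗ xs)
    , AllPairs-resp-↭ ≢-sym (↭-sym (sort-↭ xs)) distinct)

sort-unique : ∀ {xs ys} → AllPairs _<_ ys → ys ↭ xs → sort xs ≡ ys
sort-unique {xs} ys↗ ys↭xs = ≋⇒≡ (Sorted.↗↭↗⇒≋ ℚ≤.totalOrder (sort-↗ xs)
  (Sorted.AllPairs⇒Sorted ℚ≤.totalOrder (AllPairs.map <⇒≤ ys↗))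
  (↭⇒↭ₛ′ ℚ≤.isEquivalence (↭-trans (sort-↭ xs) (↭-sym ys↭xs))))

leaves-relabel : ∀ {A B C} (f : B → C) (T : BTree A B) → leaves (relabel f T) ≡ leaves T
leaves-relabel f (leaf a)     = refl
leaves-relabel f (node t l r) = cong₂ _++_ (leaves-relabel f l) (leaves-relabel f r)

internalTimes-relabel : ∀ {A B C} (f : B → C) (T : BTree A B) →
                        internalTimes (relabel f T) ≡ map f (internalTimes T)
internalTimes-relabel f (leaf a)     = refl
internalTimes-relabel f (node t l r) = cong (f t ∷_) (begin
  internalTimes (relabel f l) ++ internalTimes (relabel f r)
    ≡⟨ cong₂ _++_ (internalTimes-relabel f l) (internalTimes-relabel f r) ⟩
  map f (internalTimes l) ++ map f (internalTimes r)
    ≡⟨ map-++ f (internalTimes l) (internalTimes r) ⟨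
  map f (internalTimes l ++ internalTimes r) ∎)
  where open ≡-Reasoning

relabel-∘ : ∀ {A B C D} (f : C → D) (g : B → C) (T : BTree A B) →
            relabel f (relabel g T) ≡ relabel (λ x → f (g x)) T
relabel-∘ f g (leaf a)     = refl
relabel-∘ f g (node t l r) = cong₂ (node _) (relabel-∘ f g l) (relabel-∘ f g r)

relabel-cong-local : ∀ {A B C} {f f′ : B → C} (T : BTree A B) →
  All (λ t → f t ≡ f′ t) (internalTimes T) → relabel f T ≡ relabel f′ T
relabel-cong-local (leaf a)     _ = refl
relabel-cong-local (node t l r) (ft≡ ∷ eqs)
  rewrite ft≡
        | relabel-cong-local l (All.++⁻ˡ (internalTimes l) eqs)
        | relabel-cong-local r (All.++⁻ʳ (internalTimes l) eqs) = refl

StrictlyMonotoneOn : (ℚ → Set) → (ℚ → ℚ) → Set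
StrictlyMonotoneOn D g = ∀ {x y} → D x → D y → x < y → g x < g y

module _ {D : ℚ → Set} {g : ℚ → ℚ} (g-mono : StrictlyMonotoneOn D g) where

  monotoneOn : ∀ {x y} → D x → D y → x ≤ y → g x ≤ g y
  monotoneOn Dx Dy x≤y with ≤⇒<⊎≡ x≤y
  ... | inj₁ x<y  = <⇒≤ (g-mono Dx Dy x<y)
  ... | inj₂ refl = ≤-refl

  reflects-< : ∀ {x y} → D x → D y → g x < g y → x < y
  reflects-< {x} {y} Dx Dy gx<gy with x <? y
  ... | yes x<y = x<y
  ... | no x≮y with ≤⇒<⊎≡ (≮⇒≥ x≮y)
  ...   | inj₁ y<x  = ⊥-elim (<-asym gx<gy (g-mono Dy Dx y<x))
  ...   | inj₂ refl = ⊥-elim (<-irrefl refl gx<gy)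

  rankOf-map : ∀ {t} xs → D t → All D xs → rankOf (map g xs) (g t) ≡ rankOf xs t
  rankOf-map []       _  _           = refl
  rankOf-map {t} (x ∷ xs) Dt (Dx ∷ Dxs) = by-cases (x <? t)
    where
    by-cases : Dec (x < t) →
      length (filter (_<? g t) (g x ∷ map g xs)) ≡ length (filter (_<? t) (x ∷ xs))
    by-cases (yes x<t)
      rewrite filter-accept (_<? g t) {xs = map g xs} (g-mono Dx Dt x<t)
            | filter-accept (_<? t) {xs = xs} x<t = cong suc (rankOf-map xs Dt Dxs)
    by-cases (no x≮t)
      rewrite filter-reject (_<? g t) {xs = map g xs} (λ gx<gt → x≮t (reflects-< Dx Dt gx<gt))
            | filter-reject (_<? t) {xs = xs} x≮t = rankOf-map xs Dt Dxs

  rankify-relabel : ∀ {A} (T : BTree A ℚ) → All D (internalTimes T) →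
                    rankify (relabel g T) ≡ rankify T
  rankify-relabel T DT = begin
    relabel (rankOf (internalTimes (relabel g T))) (relabel g T)
      ≡⟨ cong (λ ts → relabel (rankOf ts) (relabel g T)) (internalTimes-relabel g T) ⟩
    relabel (rankOf (map g ts)) (relabel g T)
      ≡⟨ relabel-∘ (rankOf (map g ts)) g T ⟩
    relabel (λ t → rankOf (map g ts) (g t)) T
      ≡⟨ relabel-cong-local T (All.map (λ Dt → rankOf-map ts Dt DT) DT) ⟩
    relabel (rankOf ts) T ∎
    where
    open ≡-Reasoning
    ts = internalTimes T

  relabel-ultrametric : (∀ t → t ≤ g t) → ∀ {A} {T : BTree A ℚ} →
    All D (internalTimes T) → Ultrametric T → Ultrametric (relabel g T)
  relabel-ultrametric inflationary _ (leafU a) = leafU a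
  relabel-ultrametric inflationary {T = node t l r} (Dt ∷ Dlr) (nodeU l≤t r≤t ul ur) =
    nodeU (below l Dl l≤t) (below r Dr r≤t)
          (relabel-ultrametric inflationary Dl ul) (relabel-ultrametric inflationary Dr ur)
    where
    Dl = All.++⁻ˡ (internalTimes l) Dlr
    Dr = All.++⁻ʳ (internalTimes l) Dlr
    below : ∀ U → All D (internalTimes U) → time U ≤ t → time (relabel g U) ≤ g t
    below (leaf _)     _        U≤t = ≤-trans U≤t (inflationary t)
    below (node _ _ _) (Du ∷ _) U≤t = monotoneOn Du Dt U≤t

module _ {g : ℚ → ℚ} (inflationary : ∀ t → t ≤ g t) where

  mrcaTime-relabel : ∀ {n} (T : BTree (Fin n) ℚ) a b →
    Pointwise _≤_ (mrcaTime T a b) (mrcaTime (relabel g T) a b)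
  mrcaTime-relabel (leaf x) a b with does (a Fin.≟ x) | does (b Fin.≟ x)
  ... | true  | true  = just ≤-refl
  ... | true  | false = nothing
  ... | false | _     = nothing
  mrcaTime-relabel (node t l r) a b
    with mrcaTime l a b | mrcaTime (relabel g l) a b | mrcaTime-relabel l a b
       | mrcaTime r a b | mrcaTime (relabel g r) a b | mrcaTime-relabel r a b
  ... | _ | _ | just s≤s′ | _ | _ | _         = just s≤s′
  ... | _ | _ | nothing   | _ | _ | just s≤s′ = just s≤s′
  ... | _ | _ | nothing   | _ | _ | nothing
    rewrite leaves-relabel g l | leaves-relabel g r
    with does (DecMembership._∈?_ Fin._≟_ a (leaves l ++ leaves r))
       | does (DecMembership._∈?_ Fin._≟_ b (leaves l ++ leaves r))
  ... | true  | true  = just (inflationary t)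
  ... | true  | false = nothing
  ... | false | _     = nothing

  dist-relabel : ∀ {n} (T : BinUltraTree n) (u : Ultrametric (relabel g (tree T)))
    (lab : leaves (relabel g (tree T)) ↭ allFin n) a b →
    dist T a b ≤ dist (mkTree (relabel g (tree T)) u lab) a b
  dist-relabel T _ _ a b = double-mono (mrcaTime-relabel (tree T) a b)
    where
    double-mono : ∀ {s s′ : Maybe ℚ} → Pointwise _≤_ s s′ →
                  maybe (λ t → t + t) 0ℚ s ≤ maybe (λ t → t + t) 0ℚ s′
    double-mono (just s≤s′) = +-mono-≤ s≤s′ s≤s′
    double-mono nothing     = ≤-refl

retime : ℚ → ℚ → ℚ → ℚ
retime p p′ t with t ≟ p
... | yes _ = p′
... | no  _ = t

retime-self : ∀ p p′ → retime p p′ p ≡ p′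
retime-self p p′ with p ≟ p
... | yes _   = refl
... | no p≢p = ⊥-elim (p≢p refl)

retime-other : ∀ {p} p′ {t} → t ≢ p → retime p p′ t ≡ t
retime-other {p} p′ {t} t≢p with t ≟ p
... | yes t≡p = ⊥-elim (t≢p t≡p)
... | no _    = refl

retime-inflationary : ∀ {p p′} → p ≤ p′ → ∀ t → t ≤ retime p p′ t
retime-inflationary {p} p≤p′ t with t ≟ p
... | yes refl = p≤p′
... | no _     = ≤-refl

Avoids : ℚ → ℚ → ℚ → Set
Avoids p p′ x = x ≤ p ⊎ p′ < x

retime-strictlyMonotone : ∀ {p p′} → p ≤ p′ → StrictlyMonotoneOn (Avoids p p′) (retime p p′)
retime-strictlyMonotone {p} {p′} p≤p′ {x} {y} _ y-avoids x<y with x ≟ p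
... | no _ = <-≤-trans x<y (retime-inflationary p≤p′ y)
... | yes refl with y-avoids
...   | inj₁ y≤p  = ⊥-elim (<-irrefl refl (<-≤-trans x<y y≤p))
...   | inj₂ p′<y = subst (p′ <_) (sym (retime-other p′ (λ y≡p → <-irrefl (sym y≡p) x<y))) p′<y

-- nestingSequence N unfolds to map (hostTag (hostTimes N)) (sort (allTimes N)).
hostTag : List ℚ → ℚ → HP
hostTag hs t = if does (t ∈? hs) then H else P

hostTag≡H⇒∈ : ∀ {hs t} → hostTag hs t ≡ H → t ∈ hs
hostTag≡H⇒∈ {hs} {t} eq with t ∈? hs
... | yes t∈hs = t∈hs
hostTag≡H⇒∈ () | no _

hostTag≡P⇒∉ : ∀ {hs t} → hostTag hs t ≡ P → t ∉ hs
hostTag≡P⇒∉ {hs} {t} eq with t ∈? hs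
hostTag≡P⇒∉ () | yes _
... | no t∉hs = t∉hs

∉⇒hostTag≡P : ∀ {hs t} → t ∉ hs → hostTag hs t ≡ P
∉⇒hostTag≡P {hs} {t} t∉hs with t ∈? hs
... | yes t∈hs = ⊥-elim (t∉hs t∈hs)
... | no _     = refl

module _ {n m : ℕ} {ℓ : Fin m → Fin n} where

  hostTimes parasiteTimes allTimes : FRNestedTree n m ℓ → List ℚ
  hostTimes N     = internalTimes (tree (host N))
  parasiteTimes N = internalTimes (tree (parasite N))
  allTimes N      = hostTimes N ++ parasiteTimes N

  RankedTopologiesAgree : FRNestedTree n m ℓ → FRNestedTree n m ℓ → Set
  RankedTopologiesAgree N N′ =
    rankify (tree (host N)) ≡ rankify (tree (host N′)) ×
    rankify (tree (parasite N)) ≡ rankify (tree (parasite N′))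

  RealisedFrom : FRNestedTree n m ℓ → List HP → Set
  RealisedFrom N S =
    Σ (FRNestedTree n m ℓ) λ N′ → RankedTopologiesAgree N N′ × nestingSequence N′ ≡ S

  RealisedFrom-bind : ∀ {N S S′} → RealisedFrom N S →
    (∀ N₁ → nestingSequence N₁ ≡ S → RealisedFrom N₁ S′) → RealisedFrom N S′
  RealisedFrom-bind (N₁ , (host≡₁ , parasite≡₁) , eq₁) continue with continue N₁ eq₁
  ... | N₂ , (host≡₂ , parasite≡₂) , eq₂ =
    N₂ , (trans host≡₁ host≡₂ , trans parasite≡₁ parasite≡₂) , eq₂

module AdjacentSwap {n m ℓ} (N : FRNestedTree n m ℓ) (as : List ℚ) (p h : ℚ) (bs : List ℚ)
  (sorted≡ : sort (allTimes N) ≡ as ++ p ∷ h ∷ bs)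
  (p∉host : p ∉ hostTimes N) (h∈host : h ∈ hostTimes N) where

  window↗ : AllPairs _<_ (as ++ p ∷ h ∷ bs)
  window↗ = subst (AllPairs _<_) sorted≡ (sort-strictlyIncreasing (distinct N))

  as↗ : AllPairs _<_ as
  as↗ = proj₁ (AllPairs-++⁻ as window↗)

  p∷h∷bs↗ : AllPairs _<_ (p ∷ h ∷ bs)
  p∷h∷bs↗ = proj₁ (proj₂ (AllPairs-++⁻ as window↗))

  as<p∷h∷bs : All (λ x → All (x <_) (p ∷ h ∷ bs)) as
  as<p∷h∷bs = proj₂ (proj₂ (AllPairs-++⁻ as window↗))

  p<h : p < h
  p<h = All.head (AllPairs.head p∷h∷bs↗)

  h∷bs↗ : AllPairs _<_ (h ∷ bs)
  h∷bs↗ = AllPairs.tail p∷h∷bs↗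

  p′ : ℚ
  p′ = proj₁ (∃-above-below-all h bs h∷bs↗)

  h<p′ : h < p′
  h<p′ = proj₁ (proj₂ (∃-above-below-all h bs h∷bs↗))

  p′<bs : All (p′ <_) bs
  p′<bs = proj₂ (proj₂ (∃-above-below-all h bs h∷bs↗))

  p≤p′ : p ≤ p′
  p≤p′ = <⇒≤ (<-trans p<h h<p′)

  g : ℚ → ℚ
  g = retime p p′

  window-avoids : ∀ {x} → x ∈ as ++ p ∷ h ∷ bs → x ≡ h ⊎ Avoids p p′ x
  window-avoids x∈ with ∈-++⁻ as x∈
  ... | inj₁ x∈as                 = inj₂ (inj₁ (<⇒≤ (All.head (All.lookup as<p∷h∷bs x∈as))))
  ... | inj₂ (here refl)          = inj₂ (inj₁ ≤-refl)
  ... | inj₂ (there (here refl))  = inj₁ refl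
  ... | inj₂ (there (there x∈bs)) = inj₂ (inj₂ (All.lookup p′<bs x∈bs))

  ∈window : ∀ {x} → x ∈ allTimes N → x ∈ as ++ p ∷ h ∷ bs
  ∈window x∈ = subst (_ ∈_) sorted≡ (↭.∈-resp-↭ (↭-sym (sort-↭ (allTimes N))) x∈)

  parasite-avoids : All (Avoids p p′) (parasiteTimes N)
  parasite-avoids = All.tabulate avoids
    where
    avoids : ∀ {x} → x ∈ parasiteTimes N → Avoids p p′ x
    avoids x∈ with window-avoids (∈window (∈-++⁺ʳ (hostTimes N) x∈))
    ... | inj₁ refl = ⊥-elim (All.lookup (All.lookup cross h∈host) x∈ refl)
      where cross = proj₂ (proj₂ (AllPairs-++⁻ (hostTimes N) (distinct N)))
    ... | inj₂ x-avoids = x-avoids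

  p′∉window : p′ ∉ as ++ p ∷ h ∷ bs
  p′∉window p′∈ with window-avoids p′∈
  ... | inj₁ p′≡h        = <-irrefl (sym p′≡h) h<p′
  ... | inj₂ (inj₁ p′≤p) = <-irrefl refl (≤-<-trans p′≤p (<-trans p<h h<p′))
  ... | inj₂ (inj₂ p′<p′) = <-irrefl refl p′<p′

  host-fixed : map g (hostTimes N) ≡ hostTimes N
  host-fixed = map-id-local (All.tabulate λ x∈ →
    retime-other p′ (λ x≡p → p∉host (subst (_∈ hostTimes N) x≡p x∈)))

  map-window : map g (as ++ p ∷ h ∷ bs) ≡ as ++ p′ ∷ h ∷ bs
  map-window = begin
    map g (as ++ p ∷ h ∷ bs)             ≡⟨ map-++ g as (p ∷ h ∷ bs) ⟩
    map g as ++ g p ∷ g h ∷ map g bs     ≡⟨ cong₂ _++_ as-fixed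
                                              (cong₂ _∷_ (retime-self p p′)
                                                (cong₂ _∷_ (retime-other p′ (≢-sym (<⇒≢ p<h))) bs-fixed)) ⟩
    as ++ p′ ∷ h ∷ bs ∎
    where
    open ≡-Reasoning
    as-fixed : map g as ≡ as
    as-fixed = map-id-local (All.map (λ x<p∷h∷bs →
      retime-other p′ (<⇒≢ (All.head x<p∷h∷bs))) as<p∷h∷bs)
    bs-fixed : map g bs ≡ bs
    bs-fixed = map-id-local (All.map (λ p′<x →
      retime-other p′ (≢-sym (<⇒≢ (≤-<-trans p≤p′ p′<x)))) p′<bs)

  parasite′ : BinUltraTree m
  parasite′ = mkTree (relabel g (tree (parasite N)))
    (relabel-ultrametric (retime-strictlyMonotone p≤p′) (retime-inflationary p≤p′)
      parasite-avoids (ultra (parasite N)))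
    (subst (_↭ allFin m) (sym (leaves-relabel g (tree (parasite N)))) (labels (parasite N)))

  window′ : List ℚ
  window′ = as ++ h ∷ p′ ∷ bs

  window′↗ : AllPairs _<_ window′
  window′↗ = AllPairs.++⁺ as↗ ((h<p′ ∷ AllPairs.head h∷bs↗) ∷ p′<bs ∷ AllPairs.tail h∷bs↗)
                          (All.map below as<p∷h∷bs)
    where
    below : ∀ {x} → All (x <_) (p ∷ h ∷ bs) → All (x <_) (h ∷ p′ ∷ bs)
    below (_ ∷ x<h ∷ x<bs) = x<h ∷ <-trans x<h h<p′ ∷ x<bs

  times′↭window′ : hostTimes N ++ internalTimes (tree parasite′) ↭ window′
  times′↭window′ = begin
    hostTimes N ++ internalTimes (relabel g (tree (parasite N)))
      ≡⟨ cong₂ _++_ (sym host-fixed) (internalTimes-relabel g (tree (parasite N))) ⟩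
    map g (hostTimes N) ++ map g (parasiteTimes N)
      ≡⟨ map-++ g (hostTimes N) (parasiteTimes N) ⟨
    map g (allTimes N)
      ↭⟨ ↭.map⁺ g (↭-sym (sort-↭ (allTimes N))) ⟩
    map g (sort (allTimes N))
      ≡⟨ cong (map g) sorted≡ ⟩
    map g (as ++ p ∷ h ∷ bs)
      ≡⟨ map-window ⟩
    as ++ p′ ∷ h ∷ bs
      ↭⟨ ↭.++⁺ˡ as (↭-swap p′ h ↭-refl) ⟩
    window′ ∎
    where open PermutationReasoning

  swapped : FRNestedTree n m ℓ
  swapped = record
    { host     = host N
    ; parasite = parasite′
    ; nested   = λ i j → ≤-trans (nested N i j)
        (dist-relabel (retime-inflationary p≤p′) (parasite N) (ultra parasite′) (labels parasite′) i j)
    ; distinct = AllPairs-resp-↭ ≢-sym (↭-sym times′↭window′) (AllPairs.map <⇒≢ window′↗)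
    }

  swapped-agrees : RankedTopologiesAgree N swapped
  swapped-agrees =
    refl , sym (rankify-relabel (retime-strictlyMonotone p≤p′) (tree (parasite N)) parasite-avoids)

  nestingSequence-swapped : nestingSequence swapped ≡ map (hostTag (hostTimes N)) window′
  nestingSequence-swapped =
    cong (map (hostTag (hostTimes N))) (sort-unique window′↗ (↭-sym times′↭window′))

  p′-parasite : hostTag (hostTimes N) p′ ≡ P
  p′-parasite = ∉⇒hostTag≡P {hostTimes N} (λ p′∈ → p′∉window (∈window (∈-++⁺ˡ p′∈)))

swap-step : ∀ {n m ℓ} (N : FRNestedTree n m ℓ) xs ys → nestingSequence N ≡ xs ++ P ∷ H ∷ ys →
  RealisedFrom N (xs ++ H ∷ P ∷ ys)
swap-step N xs ys eq with map-≡-++-∷-∷⁻ (hostTag (hostTimes N)) xs (sort (allTimes N)) eq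
... | as , p , h , bs , sorted≡ , tag-as , tag-p , tag-h , tag-bs =
  swapped , swapped-agrees , (begin
    nestingSequence swapped                      ≡⟨ nestingSequence-swapped ⟩
    map tag (as ++ h ∷ p′ ∷ bs)                  ≡⟨ map-++ tag as (h ∷ p′ ∷ bs) ⟩
    map tag as ++ tag h ∷ tag p′ ∷ map tag bs    ≡⟨ cong₂ _++_ tag-as
                                                      (cong₂ _∷_ tag-h (cong₂ _∷_ p′-parasite tag-bs)) ⟩
    xs ++ H ∷ P ∷ ys ∎)
  where
  open AdjacentSwap N as p h bs sorted≡ (hostTag≡P⇒∉ tag-p) (hostTag≡H⇒∈ tag-h)
  open ≡-Reasoning
  tag = hostTag (hostTimes N)

reachable : ∀ {n m ℓ} (N : FRNestedTree n m ℓ) {S S′} → nestingSequence N ≡ S → S ≤ₙ S′ →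
  RealisedFrom N S′
reachable N eq ε                    = N , (refl , refl) , eq
reachable N eq (step xs ys ◅ steps) =
  RealisedFrom-bind {N = N} (swap-step N xs ys eq) (λ N₁ eq₁ → reachable N₁ eq₁ steps)

≅-reflexive : ∀ {A B} {T U : BTree A B} → T ≡ U → T ≅ U
≅-reflexive {T = leaf a}     refl = leaf≅ a
≅-reflexive {T = node t l r} refl = same≅ (≅-reflexive refl) (≅-reflexive refl)

mainTheorem5 : (n m : ℕ) (ℓ : Fin m → Fin n) (N : FRNestedTree n m ℓ)
    (S' : List HP) → nestingSequence N ≤ₙ S' →
    Σ (FRNestedTree n m ℓ) (λ N' →
      SameRankedTopology (host N) (host N')
      × SameRankedTopology (parasite N) (parasite N')
      × nestingSequence N' ≡ S')
mainTheorem5 n m ℓ N S' N≤S' with reachable N refl N≤S'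
... | N′ , (host≡ , parasite≡) , eq = N′ , ≅-reflexive host≡ , ≅-reflexive parasite≡ , eq
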